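{- Let $d\ge 1$, $n\ge 1$, $k\ge 0$ be integers and $r\in\{0,1,\dots,d\}$. The number of $d$-ary multi-edge trees with $n$ vertices, exactly $k$ of which have exactly $r$ children, equals the number of $d$-ary trees with $n$ vertices, exactly $k$ of which have exactly $r$ children. Consequently, the average number of vertices with exactly $r$ children is the same for uniformly random $d$-ary multi-edge trees and uniformly random $d$-ary trees with $n$ vertices.
   Context: A plane (ordered) rooted multi-edge tree is a rooted plane tree in which each non-root vertex is joined to its parent by a positive number of parallel edges; children of a vertex are linearly ordered. If a vertex has children joined to it by $k_1,\dots,k_r$ edges, its out-degree is $k_1+\dots+k_r$ (its number of children is $r$, the number of distinct child vertices). A $d$-ary multi-edge tree is such a tree in which every vertex has out-degree at most $d$. A $d$-ary tree (pruned $d$-ary tree) is a rooted tree in which each vertex has $d$ distinct positions at which a child may be attached, each position holding at most one child. -}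

module Defs where

open import Data.Nat using (ℕ; zero; suc; _+_; _≤_)
open import Data.Product using (_×_; Σ)
open import Data.Unit using (⊤)
open import Relation.Binary.PropositionalEquality using (_≡_)

-- A vertex is given by the ordered list of its children; each child
-- carries the number of parallel edges joining it to the parent.
-- The constructor `cons m t f` attaches child t by (suc m) ≥ 1 edges,
-- so multiplicities are positive by construction.

data MTree : Set
data MForest : Set

data MTree where
  node : MForest → MTree

data MForest where
  []   : MForest
  cons : (m : ℕ) → MTree → MForest → MForest

outdegF : MForest → ℕ
outdegF []           = 0
outdegF (cons m _ f) = suc m + outdegF f

childrenF : MForest → ℕ
childrenF []           = 0
childrenF (cons _ _ f) = suc (childrenF f)

sizeM  : MTree → ℕ
sizeMF : MForest → ℕ
sizeM (node f)         = suc (sizeMF f)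
sizeMF []              = 0
sizeMF (cons _ t f)    = sizeM t + sizeMF f

open import Relation.Nullary using (yes; no)
open import Data.Nat using (_≟_)

indicator : ℕ → ℕ → ℕ
indicator a b with a ≟ b
... | yes _ = 1
... | no  _ = 0

withChildrenM  : ℕ → MTree → ℕ
withChildrenMF : ℕ → MForest → ℕ
withChildrenM r (node f)       = indicator (childrenF f) r + withChildrenMF r f
withChildrenMF r []            = 0
withChildrenMF r (cons _ t f)  = withChildrenM r t + withChildrenMF r f

DaryM  : ℕ → MTree → Set
DaryMF : ℕ → MForest → Set
DaryM d (node f)       = outdegF f ≤ d × DaryMF d f
DaryMF d []            = ⊤
DaryMF d (cons _ t f)  = DaryM d t × DaryMF d f

-- d-ary (pruned) trees: each vertex has d ordered positions, each
-- either empty or holding one child subtree.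

data DTree (d : ℕ) : Set
data Slots (d : ℕ) : ℕ → Set

data DTree d where
  node : Slots d d → DTree d

data Slots d where
  []    : Slots d 0
  empty : ∀ {m} → Slots d m → Slots d (suc m)
  full  : ∀ {m} → DTree d → Slots d m → Slots d (suc m)

childrenS : ∀ {d m} → Slots d m → ℕ
childrenS []         = 0
childrenS (empty s)  = childrenS s
childrenS (full _ s) = suc (childrenS s)

sizeD : ∀ {d} → DTree d → ℕ
sizeS : ∀ {d m} → Slots d m → ℕ
sizeD (node s)   = suc (sizeS s)
sizeS []         = 0
sizeS (empty s)  = sizeS s
sizeS (full t s) = sizeD t + sizeS s

withChildrenD : ∀ {d} → ℕ → DTree d → ℕ
withChildrenS : ∀ {d m} → ℕ → Slots d m → ℕ
withChildrenD r (node s)   = indicator (childrenS s) r + withChildrenS r s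
withChildrenS r []         = 0
withChildrenS r (empty s)  = withChildrenS r s
withChildrenS r (full t s) = withChildrenD r t + withChildrenS r s

MultiTrees : (d n k r : ℕ) → Set
MultiTrees d n k r =
  Σ MTree (λ t → DaryM d t × sizeM t ≡ n × withChildrenM r t ≡ k)

DaryTrees : (d n k r : ℕ) → Set
DaryTrees d n k r =
  Σ (DTree d) (λ t → sizeD t ≡ n × withChildrenD r t ≡ k)

module Submission where

-- Read the d slots of a vertex of a d-ary tree from left to right: a child
-- preceded by m empty slots becomes a child joined by m + 1 parallel edges,
-- and the empty slots after the last child are dropped.  The out-degree of the
-- resulting vertex is the position of its last child, hence at most d, and the
-- map is invertible because the padding is determined by d.  Vertices and the
-- children of every vertex are preserved, so the bijection restricts to the
-- trees with n vertices, k of which have exactly r children.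

open import Defs
open import Data.Nat using (ℕ; zero; suc; _+_; _≤_; z≤n; s≤s)
open import Data.Nat.Properties using (≤-irrelevant; ≡-irrelevant)
open import Data.Product using (Σ; _×_; _,_; proj₁)
open import Data.Unit using (tt)
open import Function.Bundles using (_↔_; mk↔ₛ′)
open import Relation.Binary.PropositionalEquality using (_≡_; refl; sym; trans; cong; cong₂)
open import Relation.Nullary using (Irrelevant)

×-irrelevant : {A B : Set} → Irrelevant A → Irrelevant B → Irrelevant (A × B)
×-irrelevant irrA irrB (a , b) (a′ , b′) = cong₂ _,_ (irrA a a′) (irrB b b′)

Σ-≡-irrelevant : {A : Set} {B : A → Set} → (∀ a → Irrelevant (B a)) →
                 {p q : Σ A B} → proj₁ p ≡ proj₁ q → p ≡ q
Σ-≡-irrelevant irr {a , x} {.a , y} refl = cong (a ,_) (irr a x y)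

addFirstEdge : MForest → MForest
addFirstEdge []           = []
addFirstEdge (cons m t f) = cons (suc m) t f

module _ {d : ℕ} where

  toMTree : DTree d → MTree
  toMForest : ∀ {j} → Slots d j → MForest
  toMTree (node s)     = node (toMForest s)
  toMForest []         = []
  toMForest (empty s)  = addFirstEdge (toMForest s)
  toMForest (full u s) = cons 0 (toMTree u) (toMForest s)

  outdeg-toMForest : ∀ {j} (s : Slots d j) → outdegF (toMForest s) ≤ j
  outdeg-toMForest []         = z≤n
  outdeg-toMForest (full u s) = s≤s (outdeg-toMForest s)
  outdeg-toMForest (empty s) with toMForest s | outdeg-toMForest s
  ... | []         | _     = z≤n
  ... | cons _ _ _ | deg≤j = s≤s deg≤j

  toMTree-dary : (u : DTree d) → DaryM d (toMTree u)
  toMForest-dary : ∀ {j} (s : Slots d j) → DaryMF d (toMForest s)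
  toMTree-dary (node s)         = outdeg-toMForest s , toMForest-dary s
  toMForest-dary []             = tt
  toMForest-dary (full u s)     = toMTree-dary u , toMForest-dary s
  toMForest-dary (empty s) with toMForest s | toMForest-dary s
  ... | []         | _ = tt
  ... | cons _ _ _ | p = p

  sizeM-toMTree : (u : DTree d) → sizeM (toMTree u) ≡ sizeD u
  sizeMF-toMForest : ∀ {j} (s : Slots d j) → sizeMF (toMForest s) ≡ sizeS s
  sizeM-toMTree (node s)         = cong suc (sizeMF-toMForest s)
  sizeMF-toMForest []            = refl
  sizeMF-toMForest (full u s)    = cong₂ _+_ (sizeM-toMTree u) (sizeMF-toMForest s)
  sizeMF-toMForest (empty s) with toMForest s | sizeMF-toMForest s
  ... | []         | eq = eq
  ... | cons _ _ _ | eq = eq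

  childrenF-toMForest : ∀ {j} (s : Slots d j) → childrenF (toMForest s) ≡ childrenS s
  childrenF-toMForest []         = refl
  childrenF-toMForest (full u s) = cong suc (childrenF-toMForest s)
  childrenF-toMForest (empty s) with toMForest s | childrenF-toMForest s
  ... | []         | eq = eq
  ... | cons _ _ _ | eq = eq

  withChildrenM-toMTree : ∀ r (u : DTree d) → withChildrenM r (toMTree u) ≡ withChildrenD r u
  withChildrenMF-toMForest : ∀ r {j} (s : Slots d j) → withChildrenMF r (toMForest s) ≡ withChildrenS r s
  withChildrenM-toMTree r (node s) =
    cong₂ _+_ (cong (λ c → indicator c r) (childrenF-toMForest s)) (withChildrenMF-toMForest r s)
  withChildrenMF-toMForest r []         = refl
  withChildrenMF-toMForest r (full u s) =
    cong₂ _+_ (withChildrenM-toMTree r u) (withChildrenMF-toMForest r s)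
  withChildrenMF-toMForest r (empty s) with toMForest s | withChildrenMF-toMForest r s
  ... | []         | eq = eq
  ... | cons _ _ _ | eq = eq

  emptySlots : (j : ℕ) → Slots d j
  emptySlots zero    = []
  emptySlots (suc j) = empty (emptySlots j)

  toDTree : (t : MTree) → DaryM d t → DTree d
  toSlots : (f : MForest) (j : ℕ) → outdegF f ≤ j → DaryMF d f → Slots d j
  placeChild : (m : ℕ) → DTree d → (f : MForest) (j : ℕ) →
               suc m + outdegF f ≤ j → DaryMF d f → Slots d j
  toDTree (node f) (deg≤d , df)                = node (toSlots f d deg≤d df)
  toSlots [] j _ _                             = emptySlots j
  toSlots (cons m t f) j deg≤j (dt , df)       = placeChild m (toDTree t dt) f j deg≤j df
  placeChild zero    u f (suc j) (s≤s deg≤j) df = full u (toSlots f j deg≤j df)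
  placeChild (suc m) u f (suc j) (s≤s deg≤j) df = empty (placeChild m u f j deg≤j df)

  toMForest-emptySlots : ∀ j → toMForest (emptySlots j) ≡ []
  toMForest-emptySlots zero    = refl
  toMForest-emptySlots (suc j) = cong addFirstEdge (toMForest-emptySlots j)

  toMTree-toDTree : (t : MTree) (p : DaryM d t) → toMTree (toDTree t p) ≡ t
  toMForest-toSlots : (f : MForest) (j : ℕ) (deg≤j : outdegF f ≤ j) (df : DaryMF d f) →
                      toMForest (toSlots f j deg≤j df) ≡ f
  toMForest-placeChild : ∀ m (t : MTree) (dt : DaryM d t) (f : MForest) j
                         (deg≤j : suc m + outdegF f ≤ j) (df : DaryMF d f) →
                         toMForest (placeChild m (toDTree t dt) f j deg≤j df) ≡ cons m t f
  toMTree-toDTree (node f) (deg≤d , df) = cong node (toMForest-toSlots f d deg≤d df)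
  toMForest-toSlots [] j _ _ = toMForest-emptySlots j
  toMForest-toSlots (cons m t f) j deg≤j (dt , df) = toMForest-placeChild m t dt f j deg≤j df
  toMForest-placeChild zero t dt f (suc j) (s≤s deg≤j) df =
    cong₂ (cons 0) (toMTree-toDTree t dt) (toMForest-toSlots f j deg≤j df)
  toMForest-placeChild (suc m) t dt f (suc j) (s≤s deg≤j) df =
    cong addFirstEdge (toMForest-placeChild m t dt f j deg≤j df)

  toDTree-toMTree : (u : DTree d) (p : DaryM d (toMTree u)) → toDTree (toMTree u) p ≡ u
  toSlots-toMForest : ∀ {j} (s : Slots d j) (deg≤j : outdegF (toMForest s) ≤ j)
                      (df : DaryMF d (toMForest s)) → toSlots (toMForest s) j deg≤j df ≡ s
  toDTree-toMTree (node s) (deg≤d , df) = cong node (toSlots-toMForest s deg≤d df)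
  toSlots-toMForest [] _ _ = refl
  toSlots-toMForest (full u s) (s≤s deg≤j) (du , df) =
    cong₂ full (toDTree-toMTree u du) (toSlots-toMForest s deg≤j df)
  toSlots-toMForest {suc j} (empty s) = emptyCase (toMForest s) (toSlots-toMForest s)
    where
    emptyCase : (f : MForest) → (∀ deg≤j df → toSlots f j deg≤j df ≡ s) →
                ∀ deg≤j df → toSlots (addFirstEdge f) (suc j) deg≤j df ≡ empty s
    emptyCase []           ih _           _  = cong empty (ih z≤n tt)
    emptyCase (cons _ _ _) ih (s≤s deg≤j) df = cong empty (ih deg≤j df)

  sizeD-toDTree : (t : MTree) (p : DaryM d t) → sizeD (toDTree t p) ≡ sizeM t
  sizeD-toDTree t p = trans (sym (sizeM-toMTree (toDTree t p))) (cong sizeM (toMTree-toDTree t p))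

  withChildrenD-toDTree : ∀ r (t : MTree) (p : DaryM d t) → withChildrenD r (toDTree t p) ≡ withChildrenM r t
  withChildrenD-toDTree r t p =
    trans (sym (withChildrenM-toMTree r (toDTree t p))) (cong (withChildrenM r) (toMTree-toDTree t p))

  daryM-irrelevant : (t : MTree) → Irrelevant (DaryM d t)
  daryMF-irrelevant : (f : MForest) → Irrelevant (DaryMF d f)
  daryM-irrelevant (node f) = ×-irrelevant ≤-irrelevant (daryMF-irrelevant f)
  daryMF-irrelevant [] tt tt = refl
  daryMF-irrelevant (cons _ t f) = ×-irrelevant (daryM-irrelevant t) (daryMF-irrelevant f)

corollary2p6 : (d n k r : ℕ) → 1 ≤ d → 1 ≤ n → r ≤ d →
    MultiTrees d n k r ↔ DaryTrees d n k r
corollary2p6 d n k r _ _ _ = mk↔ₛ′ to from to∘from from∘to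
  where
  to : MultiTrees d n k r → DaryTrees d n k r
  to (t , dt , size≡n , count≡k) =
    toDTree t dt , trans (sizeD-toDTree t dt) size≡n , trans (withChildrenD-toDTree r t dt) count≡k

  from : DaryTrees d n k r → MultiTrees d n k r
  from (u , size≡n , count≡k) =
    toMTree u , toMTree-dary u , trans (sizeM-toMTree u) size≡n , trans (withChildrenM-toMTree r u) count≡k

  counts-irrelevant : {a b : ℕ} → Irrelevant (a ≡ n × b ≡ k)
  counts-irrelevant = ×-irrelevant ≡-irrelevant ≡-irrelevant

  to∘from : ∀ y → to (from y) ≡ y
  to∘from (u , _) = Σ-≡-irrelevant (λ _ → counts-irrelevant) (toDTree-toMTree u (toMTree-dary u))

  from∘to : ∀ x → from (to x) ≡ x
  from∘to (t , dt , _) =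
    Σ-≡-irrelevant (λ t′ → ×-irrelevant (daryM-irrelevant t′) counts-irrelevant) (toMTree-toDTree t dt)
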